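{- Let $k\ge 0$ be an integer and let $\Pi$ and $H$ be as described below. Then the Lloyd–Topor program $\Pi$ is tight relative to $\{H\}$.
   Context: Formulas are first-order formulas with equality built using $\bot,\land,\lor,\rightarrow,\forall,\exists$; $\neg F$ is $F\rightarrow\bot$, $F\leftrightarrow G$ is $(F\rightarrow G)\land(G\rightarrow F)$, $\widetilde\forall$ is universal closure; $\models$ is first-order entailment over arbitrary interpretations. A Lloyd–Topor program is a finite set of rules $p(\mathbf t)\leftarrow G$ ($p$ a predicate constant other than equality, $\mathbf t$ a tuple of terms, $G$ a formula, the body), identified with the conjunction of $\widetilde\forall(G\rightarrow p(\mathbf t))$. Signature: object constants $\widehat 0,\dots,\widehat k$; unary predicates $\mathit{object},\mathit{place},\mathit{step}$; binary $\mathit{next}$; ternary $\mathit{at},\mathit{move}$. $\Pi$ consists of the rules: the facts $\mathit{step}(\widehat 0),\dots,\mathit{step}(\widehat k)$, $\mathit{next}(\widehat 0,\widehat 1),\dots,\mathit{next}(\widehat{k-1},\widehat k)$ (facts are rules with body $\top$, i.e. $\bot\rightarrow\bot$); $\mathit{at}(x,y,u)\leftarrow\mathit{move}(x,y,z)\land\mathit{next}(z,u)$; $\mathit{at}(x,y,\widehat 0)\leftarrow\mathit{object}(x)\land\mathit{place}(y)\land\neg\neg\mathit{at}(x,y,\widehat 0)$; $\mathit{at}(x,y,u)\leftarrow\mathit{at}(x,y,z)\land\mathit{next}(z,u)\land\neg\neg\mathit{at}(x,y,u)$; $\mathit{object}(x)\leftarrow\neg\neg\mathit{object}(x)$; $\mathit{place}(y)\leftarrow\neg\neg\mathit{place}(y)$;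 $\mathit{move}(x,y,z)\leftarrow\neg\neg\mathit{move}(x,y,z)$. $H$ is the conjunction of the universal closures of: $\widehat i\ne\widehat j$ ($0\le i<j\le k$); $\mathit{at}(x,y,z)\rightarrow\mathit{object}(x)\land\mathit{place}(y)\land\mathit{step}(z)$; $\mathit{move}(x,y,z)\rightarrow\mathit{object}(x)\land\mathit{place}(y)\land\mathit{step}(z)$; $\mathit{at}(x,y_1,z)\land\mathit{at}(x,y_2,z)\rightarrow y_1=y_2$; $\mathit{object}(x)\land\mathit{step}(z)\rightarrow\exists y\,\mathit{at}(x,y,z)$. Completion: for a predicate constant $p$ (not equality), let $p(\mathbf t^i)\leftarrow G^i$ ($i=1,\dots,m$) be all rules with $p$ in the head. The completed definition of $p$ is $\forall\mathbf x(p(\mathbf x)\leftrightarrow\bigvee_i\exists\mathbf y^i(\mathbf x=\mathbf t^i\land G^i))$, with $\mathbf x$ fresh distinct variables, $\mathbf y^i$ the free variables of the $i$-th rule, $\mathbf x=\mathbf t^i$ the conjunction of componentwise equalities (empty disjunction is $\bot$). $\mathrm{Comp}[\Pi]$ is the conjunction of the completed definitions of all predicate constants (other than equality) occurring in $\Pi$. An occurrence of an expression is negated if it lies in a subformula $F\rightarrow\bot$, nonnegated otherwise; positive if the number of implications containing it in their antecedent is even. Rule dependency graph: vertices are rules of $\Pi$ with variables (free and bound) renamed arbitrarily; an edge from $p(\mathbf t)\leftarrow G$ to $p'(\mathbf t')\leftarrow G'$, labeled $p'(\mathbf s)$, whenever $p'(\mathbf s)$ has a positive nonnegated occurrence in $G$.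 A chain is a finite path whose rules pairwise share no variables; its length is the number of edges. For a chain of rules $p_i(\mathbf t^i)\leftarrow\mathit{Body}_i$ ($i=0,\dots,n$) with edge labels $p_i(\mathbf s^i)$ ($i=1,\dots,n$), the chain formula is $F_C=\bigwedge_{i=1}^n\mathbf s^i=\mathbf t^i\land\bigwedge_{i=0}^n\mathit{Body}_i$. For a set $\Gamma$ of sentences, $\Pi$ is tight relative to $\Gamma$ if there is a positive integer $n$ with $\Gamma,\mathrm{Comp}[\Pi]\models\widetilde\forall\neg F_C$ for every chain $C$ of length $n$. -}

module Defs where

open import Data.Nat using (ℕ; zero; suc; _⊔_; _<ᵇ_; _≡ᵇ_; _≤_)
open import Data.Bool using (Bool; true; false; not; if_then_else_)
open import Data.Fin using (Fin; toℕ; inject₁)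
open import Data.Fin.Base using () renaming (zero to fzero)
open import Data.List using (List; []; _∷_; _++_; map; concat; concatMap; filterᵇ; foldr; allFin)
open import Data.List.Membership.Propositional using (_∈_)
open import Data.List.Relation.Unary.AllPairs using (AllPairs)
open import Data.List.Relation.Binary.Disjoint.Propositional using (Disjoint)
open import Data.Vec using (Vec; []; _∷_; toList) renaming (map to vmap; foldr to vfoldr)
open import Data.Product using (Σ; _×_; _,_; proj₁; proj₂; ∃)
open import Data.Empty using (⊥)
open import Function.Definitions using (Injective)
open import Relation.Binary.PropositionalEquality using (_≡_)
open import Relation.Nullary using (¬_)
open import Relation.Nullary.Decidable using (does)

data Pred : Set where
  object place step next at move : Pred

arity : Pred → ℕ
arity object = 1
arity place  = 1
arity step   = 1
arity next   = 2
arity at     = 3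
arity move   = 3

predCode : Pred → ℕ
predCode object = 0
predCode place  = 1
predCode step   = 2
predCode next   = 3
predCode at     = 4
predCode move   = 5

_=ᴾ_ : Pred → Pred → Bool
p =ᴾ q = predCode p ≡ᵇ predCode q

Var : Set
Var = ℕ

module FOL (k : ℕ) where

  data Term : Set where
    var : Var → Term
    con : Fin (suc k) → Term

  data Formula : Set where
    ⊥'   : Formula
    atom : (p : Pred) → Vec Term (arity p) → Formula
    _≐_  : Term → Term → Formula
    _∧'_ : Formula → Formula → Formula
    _∨'_ : Formula → Formula → Formula
    _⇒_  : Formula → Formula → Formula
    ∀'   : Var → Formula → Formula
    ∃'   : Var → Formula → Formula

  infixr 6 _∧'_
  infixr 5 _∨'_
  infixr 4 _⇒_
  infix 7 _≐_

  ¬' : Formula → Formula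
  ¬' F = F ⇒ ⊥'

  ⊤' : Formula
  ⊤' = ⊥' ⇒ ⊥'

  _⇔_ : Formula → Formula → Formula
  F ⇔ G = (F ⇒ G) ∧' (G ⇒ F)

  ⋀ : List Formula → Formula
  ⋀ []           = ⊤'
  ⋀ (F ∷ [])     = F
  ⋀ (F ∷ G ∷ Fs) = F ∧' ⋀ (G ∷ Fs)

  ⋁ : List Formula → Formula
  ⋁ []           = ⊥'
  ⋁ (F ∷ [])     = F
  ⋁ (F ∷ G ∷ Fs) = F ∨' ⋁ (G ∷ Fs)

  eqs : ∀ {n} → Vec Term n → Vec Term n → List Formula
  eqs []       []       = []
  eqs (s ∷ ss) (t ∷ ts) = (s ≐ t) ∷ eqs ss ts

  termVars : Term → List Var
  termVars (var x) = x ∷ []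
  termVars (con _) = []

  termsVars : ∀ {n} → Vec Term n → List Var
  termsVars ts = concat (toList (vmap termVars ts))

  remove : Var → List Var → List Var
  remove x = filterᵇ (λ y → not (y ≡ᵇ x))

  fv : Formula → List Var
  fv ⊥'         = []
  fv (atom p ts) = termsVars ts
  fv (s ≐ t)    = termVars s ++ termVars t
  fv (F ∧' G)   = fv F ++ fv G
  fv (F ∨' G)   = fv F ++ fv G
  fv (F ⇒ G)    = fv F ++ fv G
  fv (∀' x F)   = remove x (fv F)
  fv (∃' x F)   = remove x (fv F)

  allVars : Formula → List Var
  allVars ⊥'         = []
  allVars (atom p ts) = termsVars ts
  allVars (s ≐ t)    = termVars s ++ termVars t
  allVars (F ∧' G)   = allVars F ++ allVars G
  allVars (F ∨' G)   = allVars F ++ allVars G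
  allVars (F ⇒ G)    = allVars F ++ allVars G
  allVars (∀' x F)   = x ∷ allVars F
  allVars (∃' x F)   = x ∷ allVars F

  ∀̃ : Formula → Formula
  ∀̃ F = foldr ∀' F (fv F)

  -- Semantics: arbitrary interpretations, classical truth
  -- (encoded by the Gödel–Gentzen negative translation, so every
  -- satisfaction type is ¬¬-stable and the semantics is two-valued
  -- classical first-order semantics)

  record Structure : Set₁ where
    field
      D   : Set
      conI : Fin (suc k) → D
      rel : (p : Pred) → Vec D (arity p) → Set

  module _ (M : Structure) where
    open Structure M

    Assignment : Set
    Assignment = Var → D

    _[_↦_] : Assignment → Var → D → Assignment
    (σ [ x ↦ d ]) y = if y ≡ᵇ x then d else σ y

    evalT : Assignment → Term → D
    evalT σ (var x) = σ x
    evalT σ (con c) = conI c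

    Sat : Assignment → Formula → Set
    Sat σ ⊥'          = ⊥
    Sat σ (atom p ts) = ¬ ¬ rel p (vmap (evalT σ) ts)
    Sat σ (s ≐ t)     = ¬ ¬ (evalT σ s ≡ evalT σ t)
    Sat σ (F ∧' G)    = Sat σ F × Sat σ G
    Sat σ (F ∨' G)    = ¬ (¬ Sat σ F × ¬ Sat σ G)
    Sat σ (F ⇒ G)     = Sat σ F → Sat σ G
    Sat σ (∀' x F)    = (d : D) → Sat (σ [ x ↦ d ]) F
    Sat σ (∃' x F)    = ¬ ((d : D) → ¬ Sat (σ [ x ↦ d ]) F)

  _⊨_ : List Formula → Formula → Set₁
  Γ ⊨ F = (M : Structure) (σ : Assignment M) →
          (∀ {G} → G ∈ Γ → Sat M σ G) → Sat M σ F

  record Rule : Set where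
    constructor _←_
    field
      {hp}  : Pred
      head  : Vec Term (arity hp)
      body  : Formula
  open Rule public

  Program : Set
  Program = List Rule

  Atom : Set
  Atom = Σ Pred (λ p → Vec Term (arity p))

  ruleFormula : Rule → Formula
  ruleFormula r = ∀̃ (body r ⇒ atom (hp r) (head r))

  ruleFV : Rule → List Var
  ruleFV r = termsVars (head r) ++ fv (body r)

  ruleAllVars : Rule → List Var
  ruleAllVars r = termsVars (head r) ++ allVars (body r)

  maxL : List ℕ → ℕ
  maxL = foldr _⊔_ 0

  predsF : Formula → List Pred
  predsF ⊥'          = []
  predsF (atom p _)  = p ∷ []
  predsF (_ ≐ _)     = []
  predsF (F ∧' G)    = predsF F ++ predsF G
  predsF (F ∨' G)    = predsF F ++ predsF G
  predsF (F ⇒ G)     = predsF F ++ predsF G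
  predsF (∀' _ F)    = predsF F
  predsF (∃' _ F)    = predsF F

  predsΠ : Program → List Pred
  predsΠ Π = concatMap (λ r → hp r ∷ predsF (body r)) Π

  freshVec : (N n : ℕ) → Vec Term n
  freshVec N zero    = []
  freshVec N (suc n) = var N ∷ freshVec (suc N) n

  freshList : (N n : ℕ) → List Var
  freshList N zero    = []
  freshList N (suc n) = N ∷ freshList (suc N) n

  disjunct : (p : Pred) → Vec Term (arity p) → Rule → List Formula
  disjunct p xs r with predCode (hp r) Data.Nat.≟ predCode p
    where import Data.Nat
  ... | Relation.Nullary.no _ = []
  disjunct p xs (_←_ {q} t G) | Relation.Nullary.yes e =
    foldr ∃' (⋀ (eqs xs (castT e t) ++ (G ∷ []))) (termsVars t ++ fv G) ∷ []
    where
    codeInj : ∀ {p q} → predCode p ≡ predCode q → p ≡ q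
    codeInj {object} {object} _ = Relation.Binary.PropositionalEquality.refl
    codeInj {place} {place} _ = Relation.Binary.PropositionalEquality.refl
    codeInj {step} {step} _ = Relation.Binary.PropositionalEquality.refl
    codeInj {next} {next} _ = Relation.Binary.PropositionalEquality.refl
    codeInj {at} {at} _ = Relation.Binary.PropositionalEquality.refl
    codeInj {move} {move} _ = Relation.Binary.PropositionalEquality.refl
    castT : predCode q ≡ predCode p → Vec Term (arity q) → Vec Term (arity p)
    castT e v = Relation.Binary.PropositionalEquality.subst (λ r → Vec Term (arity r)) (codeInj e) v

  freshBase : Program → ℕ
  freshBase Π = suc (maxL (concatMap ruleAllVars Π))

  compDef : Program → Pred → Formula
  compDef Π p =
    foldr ∀' (atom p xs ⇔ ⋁ (concatMap (disjunct p xs) Π)) (freshList N (arity p))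
    where
    N  = freshBase Π
    xs = freshVec N (arity p)

  Comp : Program → Formula
  Comp Π = ⋀ (map (compDef Π) (predsΠ Π))

  -- positive nonnegated occurrences of atoms (flag: current polarity is positive)
  posNN : Bool → Formula → List Atom
  posNN pol ⊥'          = []
  posNN pol (atom p ts) = if pol then (p , ts) ∷ [] else []
  posNN pol (_ ≐ _)     = []
  posNN pol (F ∧' G)    = posNN pol F ++ posNN pol G
  posNN pol (F ∨' G)    = posNN pol F ++ posNN pol G
  posNN pol (F ⇒ ⊥')    = []
  posNN pol (F ⇒ G)     = posNN (not pol) F ++ posNN pol G
  posNN pol (∀' _ F)    = posNN pol F
  posNN pol (∃' _ F)    = posNN pol F

  renT : (Var → Var) → Term → Term
  renT ρ (var x) = var (ρ x)
  renT ρ (con c) = con c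

  renF : (Var → Var) → Formula → Formula
  renF ρ ⊥'          = ⊥'
  renF ρ (atom p ts) = atom p (vmap (renT ρ) ts)
  renF ρ (s ≐ t)     = renT ρ s ≐ renT ρ t
  renF ρ (F ∧' G)    = renF ρ F ∧' renF ρ G
  renF ρ (F ∨' G)    = renF ρ F ∨' renF ρ G
  renF ρ (F ⇒ G)     = renF ρ F ⇒ renF ρ G
  renF ρ (∀' x F)    = ∀' (ρ x) (renF ρ F)
  renF ρ (∃' x F)    = ∃' (ρ x) (renF ρ F)

  renR : (Var → Var) → Rule → Rule
  renR ρ (t ← G) = vmap (renT ρ) t ← renF ρ G

  record Vertex (Π : Program) : Set where
    constructor vertex
    field
      rule    : Rule
      inΠ     : rule ∈ Π
      ρ       : Var → Var
      ρ-inj   : Injective _≡_ _≡_ ρ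
  open Vertex public

  vRule : ∀ {Π} → Vertex Π → Rule
  vRule v = renR (ρ v) (rule v)

  -- finite paths of the rule dependency graph with n edges, starting at a vertex;
  -- each edge carries its label p'(s), a positive nonnegated occurrence in the
  -- body of the source whose predicate is the head predicate of the target
  data Path (Π : Program) : ℕ → Vertex Π → Set where
    end  : (v : Vertex Π) → Path Π 0 v
    edge : ∀ {n} (v w : Vertex Π) (s : Vec Term (arity (hp (vRule w)))) →
           (hp (vRule w) , s) ∈ posNN true (body (vRule v)) →
           Path Π n w → Path Π (suc n) v

  pathVertices : ∀ {Π n v} → Path Π n v → List (Vertex Π)
  pathVertices (end v)          = v ∷ []
  pathVertices (edge v w s _ p) = v ∷ pathVertices p

  IsChain : ∀ {Π n v} → Path Π n v → Set
  IsChain p = AllPairs (λ v w → Disjoint (ruleAllVars (vRule v)) (ruleAllVars (vRule w)))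
                       (pathVertices p)

  chainEqs : ∀ {Π n v} → Path Π n v → List Formula
  chainEqs (end v)          = []
  chainEqs (edge v w s _ p) = eqs s (head (vRule w)) ++ chainEqs p

  chainBodies : ∀ {Π n v} → Path Π n v → List Formula
  chainBodies (end v)          = body (vRule v) ∷ []
  chainBodies (edge v w s _ p) = body (vRule v) ∷ chainBodies p

  chainFormula : ∀ {Π n v} → Path Π n v → Formula
  chainFormula p = ⋀ (chainEqs p ++ chainBodies p)

  TightRel : Program → List Formula → Set₁
  TightRel Π Γ = Σ ℕ λ n → (1 ≤ n) ×
    ((v : Vertex Π) (C : Path Π n v) → IsChain C →
      (Γ ++ Comp Π ∷ []) ⊨ ∀̃ (¬' (chainFormula C)))

  ĉ : Fin (suc k) → Term
  ĉ = con

  c0 : Term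
  c0 = con fzero

  vx vy vz vu vy₁ vy₂ : Term
  vx = var 0
  vy = var 1
  vz = var 2
  vu = var 3
  vy₁ = var 4
  vy₂ = var 5

  mkR : (p : Pred) → Vec Term (arity p) → Formula → Rule
  mkR p t G = _←_ {p} t G

  stepFacts : List Rule
  stepFacts = map (λ i → mkR step (ĉ i ∷ []) ⊤') (allFin (suc k))

  nextFacts : List Rule
  nextFacts = map (λ i → mkR next (ĉ (inject₁ i) ∷ ĉ (Data.Fin.suc i) ∷ []) ⊤') (allFin k)
    where import Data.Fin

  otherRules : List Rule
  otherRules =
      mkR at (vx ∷ vy ∷ vu ∷ []) (atom move (vx ∷ vy ∷ vz ∷ []) ∧' atom next (vz ∷ vu ∷ []))
    ∷ mkR at (vx ∷ vy ∷ c0 ∷ [])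
        (atom object (vx ∷ []) ∧' atom place (vy ∷ []) ∧' ¬' (¬' (atom at (vx ∷ vy ∷ c0 ∷ []))))
    ∷ mkR at (vx ∷ vy ∷ vu ∷ [])
        (atom at (vx ∷ vy ∷ vz ∷ []) ∧' atom next (vz ∷ vu ∷ []) ∧' ¬' (¬' (atom at (vx ∷ vy ∷ vu ∷ []))))
    ∷ mkR object (vx ∷ []) (¬' (¬' (atom object (vx ∷ []))))
    ∷ mkR place (vy ∷ []) (¬' (¬' (atom place (vy ∷ []))))
    ∷ mkR move (vx ∷ vy ∷ vz ∷ []) (¬' (¬' (atom move (vx ∷ vy ∷ vz ∷ []))))
    ∷ []

  Π : Program
  Π = stepFacts ++ nextFacts ++ otherRules

  distinct : List Formula
  distinct = concatMap (λ i → concatMap (λ j →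
               if toℕ i <ᵇ toℕ j then ∀̃ (¬' (ĉ i ≐ ĉ j)) ∷ [] else [])
               (allFin (suc k))) (allFin (suc k))

  H : Formula
  H = ⋀ (distinct ++
        ∀̃ (atom at (vx ∷ vy ∷ vz ∷ []) ⇒
              atom object (vx ∷ []) ∧' atom place (vy ∷ []) ∧' atom step (vz ∷ []))
      ∷ ∀̃ (atom move (vx ∷ vy ∷ vz ∷ []) ⇒
              atom object (vx ∷ []) ∧' atom place (vy ∷ []) ∧' atom step (vz ∷ []))
      ∷ ∀̃ (atom at (vx ∷ vy₁ ∷ vz ∷ []) ∧' atom at (vx ∷ vy₂ ∷ vz ∷ []) ⇒ vy₁ ≐ vy₂)
      ∷ ∀̃ (atom object (vx ∷ []) ∧' atom step (vz ∷ []) ⇒ ∃' 1 (atom at (vx ∷ vy ∷ vz ∷ [])))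
      ∷ [])

open FOL public

-- Only the three rules with head at have successors in the rule dependency graph, and of
-- their body atoms only the at-atom of the inertia rule leads to a rule that has successors.
-- So a path of length n + 2 starts at the inertia rule and runs through inertia rules; the
-- chain equations identify the z of each of them with the u of the next one, so the atoms
-- next(z, u) of the bodies form a descending next-sequence of length n + 1. The completion
-- allows next only between consecutive constants, which H makes pairwise distinct, so such
-- a sequence is shorter than k + 1 and every chain of length k + 2 is refuted.

module Submission where

open import Data.Nat using (ℕ; zero; suc; _≤_; _<_; _≡ᵇ_; _<ᵇ_; z≤n; s≤s)
open import Data.Nat.Properties using (<-cmp; 1+n≢n; ≤⇒≯; ≡ᵇ⇒≡; ≡⇒≡ᵇ; <⇒<ᵇ)
open import Data.Fin using (Fin; toℕ; inject₁; suc)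
open import Data.Fin.Properties using (toℕ-injective; toℕ-inject₁; toℕ<n)
open import Data.Bool using (Bool; true; false; T; if_then_else_)
open import Data.List using ([]; _∷_; _++_; foldr; map; concatMap; allFin)
open import Data.List.Membership.Propositional using (_∈_; lose)
open import Data.List.Membership.Propositional.Properties using (∈-++⁻; ∈-++⁺ʳ; ∈-map⁻; ∈-allFin; ∈-concatMap⁺)
open import Data.List.Relation.Unary.Any using (here; there)
open import Data.List.Relation.Unary.All as All using (All; []; _∷_)
open import Data.List.Relation.Unary.All.Properties using (++⁻; ++⁻ˡ; map⁺; map⁻; concat⁺)
open import Data.Vec using ([]; _∷_)
open import Data.Product using (Σ; _×_; _,_; proj₁; proj₂)
open import Data.Sum using (inj₁; inj₂)
open import Data.Empty using (⊥-elim)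
open import Data.Unit using (⊤; tt)
open import Effect.Monad using (RawMonad)
open import Function using (_∘_)
open import Function.Definitions using (Injective)
open import Level using (0ℓ)
open import Relation.Binary using (tri<; tri≈; tri>)
open import Relation.Binary.PropositionalEquality using (_≡_; _≢_; refl; sym; trans; subst; cong; cong₂)
open import Relation.Nullary using (¬_)
open import Relation.Nullary.Negation using (¬¬-Monad)

open import Defs using (Var; Pred; object; place; step; next; at; move; module FOL)

open RawMonad (¬¬-Monad {0ℓ})

module Tightness (k : ℕ) where
  open FOL k

  ∈-if : ∀ {A : Set} {b : Bool} {x : A} → T b → x ∈ (if b then x ∷ [] else [])
  ∈-if {b = true} _ = here refl

  module Satisfaction (M : Structure) where
    open Structure M

    update-≡ : (σ : Assignment M) (x : Var) (d : D) → (_[_↦_] M σ x d) x ≡ d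
    update-≡ σ x d with x ≡ᵇ x | ≡⇒≡ᵇ x x refl
    ... | true | _ = refl

    update-≢ : (σ : Assignment M) {x y : Var} (d : D) → x ≢ y → (_[_↦_] M σ y d) x ≡ σ x
    update-≢ σ {x} {y} d x≢y with x ≡ᵇ y in eq
    ... | true  = ⊥-elim (x≢y (≡ᵇ⇒≡ x y (subst T (sym eq) tt)))
    ... | false = refl

    Sat-⋀⁻ : ∀ {σ} Fs → Sat M σ (⋀ Fs) → All (Sat M σ) Fs
    Sat-⋀⁻ []           _         = []
    Sat-⋀⁻ (F ∷ [])     sF        = sF ∷ []
    Sat-⋀⁻ (F ∷ G ∷ Fs) (sF , sR) = sF ∷ Sat-⋀⁻ (G ∷ Fs) sR

    Sat-⋁⁻ : ∀ {σ} Fs → Sat M σ (⋁ Fs) → ¬ All (¬_ ∘ Sat M σ) Fs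
    Sat-⋁⁻ []           s _              = s
    Sat-⋁⁻ (F ∷ [])     s (¬sF ∷ [])     = ¬sF s
    Sat-⋁⁻ (F ∷ G ∷ Fs) s (¬sF ∷ ¬sRest) = s (¬sF , λ sR → Sat-⋁⁻ (G ∷ Fs) sR ¬sRest)

    Sat-∀*⁺ : ∀ {σ} xs G → (∀ τ → Sat M τ G) → Sat M σ (foldr ∀' G xs)
    Sat-∀*⁺ []       G h = h _
    Sat-∀*⁺ (x ∷ xs) G h = λ _ → Sat-∀*⁺ xs G h

    Sat-∀̃⁺ : ∀ {σ} G → (∀ τ → Sat M τ G) → Sat M σ (∀̃ G)
    Sat-∀̃⁺ G = Sat-∀*⁺ (fv G) G

  effect-rule initial-rule inertia-rule object-rule place-rule move-rule : Rule
  effect-rule = mkR at (vx ∷ vy ∷ vu ∷ []) (atom move (vx ∷ vy ∷ vz ∷ []) ∧' atom next (vz ∷ vu ∷ []))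
  initial-rule = mkR at (vx ∷ vy ∷ c0 ∷ [])
    (atom object (vx ∷ []) ∧' atom place (vy ∷ []) ∧' ¬' (¬' (atom at (vx ∷ vy ∷ c0 ∷ []))))
  inertia-rule = mkR at (vx ∷ vy ∷ vu ∷ [])
    (atom at (vx ∷ vy ∷ vz ∷ []) ∧' atom next (vz ∷ vu ∷ []) ∧' ¬' (¬' (atom at (vx ∷ vy ∷ vu ∷ []))))
  object-rule = mkR object (vx ∷ []) (¬' (¬' (atom object (vx ∷ []))))
  place-rule = mkR place (vy ∷ []) (¬' (¬' (atom place (vy ∷ []))))
  move-rule = mkR move (vx ∷ vy ∷ vz ∷ []) (¬' (¬' (atom move (vx ∷ vy ∷ vz ∷ []))))

  data RuleOfΠ : Rule → Set where
    step-fact     : (i : Fin (suc k)) → RuleOfΠ (mkR step (ĉ i ∷ []) ⊤')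
    next-fact     : (i : Fin k) → RuleOfΠ (mkR next (ĉ (inject₁ i) ∷ ĉ (suc i) ∷ []) ⊤')
    effect        : RuleOfΠ effect-rule
    initial       : RuleOfΠ initial-rule
    inertia       : RuleOfΠ inertia-rule
    object-choice : RuleOfΠ object-rule
    place-choice  : RuleOfΠ place-rule
    move-choice   : RuleOfΠ move-rule

  ruleOfOtherRules : ∀ {r} → r ∈ otherRules → RuleOfΠ r
  ruleOfOtherRules (here refl)                                         = effect
  ruleOfOtherRules (there (here refl))                                 = initial
  ruleOfOtherRules (there (there (here refl)))                         = inertia
  ruleOfOtherRules (there (there (there (here refl))))                 = object-choice
  ruleOfOtherRules (there (there (there (there (here refl)))))         = place-choice
  ruleOfOtherRules (there (there (there (there (there (here refl)))))) = move-choice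

  ruleOfΠ : ∀ {r} → r ∈ Π → RuleOfΠ r
  ruleOfΠ r∈Π with ∈-++⁻ stepFacts r∈Π
  ... | inj₁ r∈steps with ∈-map⁻ _ r∈steps
  ...   | i , _ , refl = step-fact i
  ruleOfΠ _ | inj₂ r∈rest with ∈-++⁻ nextFacts r∈rest
  ... | inj₁ r∈nexts with ∈-map⁻ _ r∈nexts
  ...   | i , _ , refl = next-fact i
  ruleOfΠ _ | inj₂ _ | inj₂ r∈others = ruleOfOtherRules r∈others

  effect∈Π : effect-rule ∈ Π
  effect∈Π = ∈-++⁺ʳ stepFacts (∈-++⁺ʳ nextFacts (here refl))

  next∈predsΠ : next ∈ predsΠ Π
  next∈predsΠ = ∈-concatMap⁺ (λ r → hp r ∷ predsF (body r)) (lose effect∈Π (there (there (here refl))))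

  ∈-distinct : ∀ {i j} → toℕ i < toℕ j → ∀̃ (¬' (ĉ i ≐ ĉ j)) ∈ distinct
  ∈-distinct {i} {j} i<j =
    ∈-concatMap⁺ (λ i' → concatMap (λ j' → if toℕ i' <ᵇ toℕ j' then ∀̃ (¬' (ĉ i' ≐ ĉ j')) ∷ [] else []) (allFin (suc k)))
      (lose (∈-allFin i)
        (∈-concatMap⁺ (λ j' → if toℕ i <ᵇ toℕ j' then ∀̃ (¬' (ĉ i ≐ ĉ j')) ∷ [] else [])
          (lose (∈-allFin j) (∈-if (<⇒<ᵇ i<j)))))

  labels-not-at : ∀ {p q r : Pred} {a b s} → p ≢ at → q ≢ at →
                  _∈_ {A = Atom} (r , s) ((p , a) ∷ (q , b) ∷ []) → r ≢ at
  labels-not-at p≢at _    (here refl)         = p≢at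
  labels-not-at _    q≢at (there (here refl)) = q≢at

  no-edge-from : ∀ {n r i} {ρ : Var → Var} {inj : Injective _≡_ _≡_ ρ} → RuleOfΠ r → hp (renR ρ r) ≢ at →
                 ¬ Path Π (suc n) (vertex r i ρ inj)
  no-edge-from effect        hp≢at _ = hp≢at refl
  no-edge-from initial       hp≢at _ = hp≢at refl
  no-edge-from inertia       hp≢at _ = hp≢at refl
  no-edge-from (step-fact _) _ (edge _ _ _ () _)
  no-edge-from (next-fact _) _ (edge _ _ _ () _)
  no-edge-from object-choice _ (edge _ _ _ () _)
  no-edge-from place-choice  _ (edge _ _ _ () _)
  no-edge-from move-choice   _ (edge _ _ _ () _)

  long-path-source≡inertia : ∀ {n r i} {ρ : Var → Var} {inj : Injective _≡_ _≡_ ρ} → RuleOfΠ r →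
                             Path Π (suc (suc n)) (vertex r i ρ inj) → r ≡ inertia-rule
  long-path-source≡inertia inertia _ = refl
  long-path-source≡inertia effect (edge _ (vertex _ i' _ _) _ label C) =
    ⊥-elim (no-edge-from (ruleOfΠ i') (labels-not-at (λ ()) (λ ()) label) C)
  long-path-source≡inertia initial (edge _ (vertex _ i' _ _) _ label C) =
    ⊥-elim (no-edge-from (ruleOfΠ i') (labels-not-at (λ ()) (λ ()) label) C)
  long-path-source≡inertia (step-fact _) (edge _ _ _ () _)
  long-path-source≡inertia (next-fact _) (edge _ _ _ () _)
  long-path-source≡inertia object-choice (edge _ _ _ () _)
  long-path-source≡inertia place-choice  (edge _ _ _ () _)
  long-path-source≡inertia move-choice   (edge _ _ _ () _)

  module ProgramSemantics (M : Structure) where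
    open Structure M
    open Satisfaction M

    Consecutive : D → D → Set
    Consecutive b a = Σ (Fin k) λ i → b ≡ conI (inject₁ i) × a ≡ conI (suc i)

    Comp-next⇒Consecutive : ∀ {σ} → Sat M σ (Comp Π) →
                            ∀ {b a} → ¬ ¬ rel next (b ∷ a ∷ []) → ¬ ¬ Consecutive b a
    Comp-next⇒Consecutive {σ} comp {b} {a} next-ba ¬consecutive =
      Sat-⋁⁻ _ (proj₁ (next-definition b a) next-xy) (concat⁺ (map⁺ (All.tabulate (no-disjunct ∘ ruleOfΠ))))
      where
      N : Var
      N = freshBase Π

      τ : Assignment M
      τ = _[_↦_] M (_[_↦_] M σ N b) (suc N) a

      τN≡b : τ N ≡ b
      τN≡b = trans (update-≢ (_[_↦_] M σ N b) {N} {suc N} a (1+n≢n ∘ sym)) (update-≡ σ N b)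

      τ1+N≡a : τ (suc N) ≡ a
      τ1+N≡a = update-≡ (_[_↦_] M σ N b) (suc N) a

      next-definition : Sat M σ (compDef Π next)
      next-definition = All.lookup (map⁻ (Sat-⋀⁻ (map (compDef Π) (predsΠ Π)) comp)) next∈predsΠ

      next-xy : ¬ ¬ rel next (τ N ∷ τ (suc N) ∷ [])
      next-xy = subst (λ v → ¬ ¬ rel next v) (sym (cong₂ (λ x y → x ∷ y ∷ []) τN≡b τ1+N≡a)) next-ba

      no-disjunct : ∀ {r} → RuleOfΠ r → All (¬_ ∘ Sat M τ) (disjunct next (freshVec N 2) r)
      no-disjunct (next-fact i) = (λ (x≡ , y≡ , _) → x≡ λ e₁ → y≡ λ e₂ →
        ¬consecutive (i , trans (sym τN≡b) e₁ , trans (sym τ1+N≡a) e₂)) ∷ []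
      no-disjunct (step-fact _) = []
      no-disjunct effect        = []
      no-disjunct initial       = []
      no-disjunct inertia       = []
      no-disjunct object-choice = []
      no-disjunct place-choice  = []
      no-disjunct move-choice   = []

    H⇒apart : ∀ {σ} → Sat M σ H → ∀ {i j} → toℕ i < toℕ j → conI i ≢ conI j
    H⇒apart h i<j ci≡cj = All.lookup (++⁻ˡ distinct (Sat-⋀⁻ _ h)) (∈-distinct i<j) λ ci≢cj → ci≢cj ci≡cj

    H⇒conI-injective : ∀ {σ} → Sat M σ H → ∀ {i j} → conI i ≡ conI j → i ≡ j
    H⇒conI-injective h {i} {j} ci≡cj with <-cmp (toℕ i) (toℕ j)
    ... | tri< i<j _ _ = ⊥-elim (H⇒apart h i<j ci≡cj)
    ... | tri≈ _ i≡j _ = toℕ-injective i≡j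
    ... | tri> _ _ j<i = ⊥-elim (H⇒apart h j<i (sym ci≡cj))

    NextPath : ℕ → D → Set
    NextPath zero    a = ⊤
    NextPath (suc d) a = Σ D λ b → ¬ ¬ rel next (b ∷ a ∷ []) × NextPath d b

    module _ (consecutive : ∀ {b a} → ¬ ¬ rel next (b ∷ a ∷ []) → ¬ ¬ Consecutive b a)
             (conI-injective : ∀ {i j} → conI i ≡ conI j → i ≡ j) where

      NextPath⇒index : ∀ d {a} → NextPath (suc d) a → ¬ ¬ Σ (Fin k) λ i → a ≡ conI (suc i) × d ≤ toℕ i
      NextPath⇒index zero (b , next-ba , _) = do
        (i , _ , a≡) ← consecutive next-ba
        pure (i , a≡ , z≤n)
      NextPath⇒index (suc d) (b , next-ba , path) = do
        (i , b≡ , a≡) ← consecutive next-ba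
        (j , b≡′ , d≤j) ← NextPath⇒index d path
        let toℕi≡1+toℕj = trans (sym (toℕ-inject₁ i)) (cong toℕ (conI-injective (trans (sym b≡) b≡′)))
        pure (i , a≡ , subst (suc d ≤_) (sym toℕi≡1+toℕj) (s≤s d≤j))

      ¬NextPath : ∀ {a} → ¬ NextPath (suc k) a
      ¬NextPath path = NextPath⇒index k path λ (i , _ , k≤i) → ≤⇒≯ k≤i (toℕ<n i)

    inertia-chain⇒NextPath : ∀ {σ n i} {ρ : Var → Var} {inj : Injective _≡_ _≡_ ρ}
      (C : Path Π (suc (suc n)) (vertex inertia-rule i ρ inj)) →
      All (Sat M σ) (chainEqs C) → All (Sat M σ) (chainBodies C) → ¬ ¬ NextPath (suc n) (σ (ρ 3))
    inertia-chain⇒NextPath {n = zero} (edge _ _ _ _ _) _ ((_ , next-zu , _) ∷ _) = pure (_ , next-zu , tt)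
    inertia-chain⇒NextPath {σ} {suc n} {ρ = ρ} (edge _ (vertex _ i′ _ _) _ label C) sat-eqs (sat-body ∷ sat-bodies)
      with long-path-source≡inertia (ruleOfΠ i′) C
    ... | refl with label
    ...   | there (here ())
    ...   | here refl with ++⁻ (_ ∷ _ ∷ _ ∷ []) sat-eqs
    ...     | (_ ∷ _ ∷ z≐u′ ∷ []) , sat-eqsC = do
              z≡u′ ← z≐u′
              path ← inertia-chain⇒NextPath C sat-eqsC sat-bodies
              pure (σ (ρ 2) , proj₁ (proj₂ sat-body) , subst (NextPath (suc n)) (sym z≡u′) path)

    long-chain-refuted : ∀ {σ v} → Sat M σ H → Sat M σ (Comp Π) →
                         (C : Path Π (suc (suc k)) v) → Sat M σ (∀̃ (¬' (chainFormula C)))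
    long-chain-refuted {v = vertex _ i _ _} h comp C with long-path-source≡inertia (ruleOfΠ i) C
    ... | refl = Sat-∀̃⁺ (¬' (chainFormula C)) λ τ sat-C →
      let sat-eqs , sat-bodies = ++⁻ (chainEqs C) (Sat-⋀⁻ (chainEqs C ++ chainBodies C) sat-C)
      in inertia-chain⇒NextPath C sat-eqs sat-bodies
           (¬NextPath (Comp-next⇒Consecutive comp) (H⇒conI-injective h))

open Tightness.ProgramSemantics using (long-chain-refuted)
open import Defs using (TightRel; Π; H)

lemma1 : (k : ℕ) → TightRel k (Π k) (H k ∷ [])
lemma1 k = suc (suc k) , s≤s z≤n , λ v C _ M σ Γ⊨ →
  long-chain-refuted k M (Γ⊨ (here refl)) (Γ⊨ (there (here refl))) C
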